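{- Let $M$ be a Turing machine and let $\mathcal{H}_M$ be as in the context. Then $\operatorname{Ldim}(\mathcal{H}_M)=K$ if $M$ halts after exactly $K$ steps on the empty input, and $\operatorname{Ldim}(\mathcal{H}_M)=\infty$ otherwise.
   Context: $\mathbb{N}=\{0,1,2,\dots\}$. Let $c_c(\{0,1\})$ be the set of finitely supported sequences $a:\mathbb{N}\to\{0,1\}$. For a Turing machine $M$ and $a\in c_c(\{0,1\})$, define $h_a:\mathbb{N}\to\{0,1\}$ by $h_a(n)=a(n)$ if $M$ does not halt after $\le n$ steps on the empty input, and $h_a(n)=0$ otherwise; $\mathcal{H}_M=\{h_a: a\in c_c(\{0,1\})\}$. A family $\{x_{\mathbf v}\}_{\mathbf v\in\{0,1\}^k, 0\le k<d}\subseteq\mathbb{N}$ indexed by nodes of a complete binary tree is a Littlestone tree of depth $d\le\infty$ of $\mathcal{G}\subseteq\{0,1\}^{\mathbb{N}}$ if for every $y_1,y_2,\dots\in\{0,1\}$ and every $0\le n<d$ there is $g\in\mathcal{G}$ with $g(x_{y_1\dots y_k})=y_{k+1}$ for all $0\le k\le n$. $\operatorname{Ldim}(\mathcal{G})=\sup\{d\in\mathbb{N}: \mathcal{G}\text{ has a Littlestone tree of depth }d\}$. -}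

module Defs where

open import Data.Nat using (ℕ; zero; suc; _≤_; _<_)
open import Data.Integer as ℤ using (ℤ; +_; _≟_)
open import Data.Fin using (Fin)
open import Data.Bool using (Bool; true; false; if_then_else_)
open import Data.Maybe using (Maybe; just; nothing)
open import Data.Product using (Σ; ∃; _×_; _,_)
open import Data.List using (List; map; upTo)
open import Relation.Nullary using (¬_; does)
open import Relation.Binary.PropositionalEquality using (_≡_)

-- Turing machines (single two-way infinite tape, finite state set,
-- finite tape alphabet Fin (suc nSymbols) whose symbol `zero` is the
-- blank).  The machine halts when the transition function is undefined
-- (returns `nothing`) on the current (state, scanned symbol).

data Move : Set where
  left right : Move

record TM : Set where
  field
    nStates  : ℕ
    nSymbols : ℕ
    start    : Fin (suc nStates)
    δ        : Fin (suc nStates) → Fin (suc nSymbols)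
             → Maybe (Fin (suc nStates) × Fin (suc nSymbols) × Move)

module _ (M : TM) where
  open TM M

  Sym : Set
  Sym = Fin (suc nSymbols)

  record Config : Set where
    constructor config
    field
      state : Fin (suc nStates)
      tape  : ℤ → Sym
      head  : ℤ

  initConfig : Config
  initConfig = config start (λ _ → Fin.zero) (+ 0)
    where import Data.Fin as Fin

  write : (ℤ → Sym) → ℤ → Sym → (ℤ → Sym)
  write t h s i = if does (i ≟ h) then s else t i

  moveHead : Move → ℤ → ℤ
  moveHead left  h = h ℤ.- ℤ.1ℤ
  moveHead right h = h ℤ.+ ℤ.1ℤ

  isHalted : Config → Bool
  isHalted (config q t h) with δ q (t h)
  ... | nothing = true
  ... | just _  = false

  step : Config → Config
  step (config q t h) with δ q (t h)
  ... | nothing = config q t h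
  ... | just (q' , s , m) = config q' (write t h s) (moveHead m h)

  run : ℕ → Config → Config
  run zero    c = c
  run (suc n) c = run n (step c)

  haltsWithin : ℕ → Bool
  haltsWithin n = isHalted (run n initConfig)

  HaltsWithin : ℕ → Set
  HaltsWithin n = haltsWithin n ≡ true

  HaltsExactly : ℕ → Set
  HaltsExactly K = HaltsWithin K × (∀ m → m < K → ¬ HaltsWithin m)

FinSupp : (ℕ → Bool) → Set
FinSupp a = ∃ λ N → ∀ n → N ≤ n → a n ≡ false

h : TM → (ℕ → Bool) → ℕ → Bool
h M a n = if haltsWithin M n then false else a n

H : TM → (ℕ → Bool) → Set
H M g = Σ (ℕ → Bool) λ a → FinSupp a × (∀ n → g n ≡ h M a n)

Class : Set₁
Class = (ℕ → Bool) → Set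

-- y_1 … y_k, where the path y_1,y_2,… is encoded as y : ℕ → Bool with
-- y i = y_{i+1}
prefix : (ℕ → Bool) → ℕ → List Bool
prefix y k = map y (upTo k)

-- x : nodes (finite 0/1 words) → ℕ; only nodes of length < d matter.
IsLittlestoneTree : Class → ℕ → (List Bool → ℕ) → Set
IsLittlestoneTree G d x =
  ∀ (y : ℕ → Bool) (n : ℕ) → n < d →
    ∃ λ g → G g × (∀ k → k ≤ n → g (x (prefix y k)) ≡ y k)

HasLittlestoneTree : Class → ℕ → Set
HasLittlestoneTree G d = ∃ λ x → IsLittlestoneTree G d x

data ℕ∞ : Set where
  fin : ℕ → ℕ∞
  ∞   : ℕ∞

LdimIs : Class → ℕ∞ → Set
LdimIs G (fin k) = HasLittlestoneTree G k × (∀ d → HasLittlestoneTree G d → d ≤ k)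
LdimIs G ∞       = ∀ d → HasLittlestoneTree G d

-- A tree of depth d for a class all of whose members vanish outside a finite
-- set F has d ≤ |F|: the root label must lie in F (its "true" branch must be
-- realised), and the "false" child is a tree of depth d - 1 for a class
-- supported on F minus the root label.  If M halts after exactly K steps, every
-- member of H_M vanishes from K on, so Ldim ≤ K.  Conversely, as long as M has
-- not halted, H_M realises every finite pattern on an initial segment, so
-- labelling each node by its depth gives a tree of that depth.
module Submission where

open import Defs
open import Data.Bool using (Bool; true; false; if_then_else_)
open import Data.Bool.Properties using (¬-not)
open import Data.Maybe using (just; nothing)
open import Data.List using (List; []; _∷_; length; upTo; filter)
open import Data.List.Properties using (length-map; length-upTo; map-upTo; map-applyUpTo; filter-notAll)
open import Data.List.Membership.Propositional using (_∉_)
open import Data.List.Membership.Propositional.Properties using (∈-upTo⁺; ∈-filter⁺)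
open import Data.List.Relation.Unary.Any as Any using ()
open import Data.Nat using (ℕ; zero; suc; _≤_; _<_; _≤′_; ≤′-reflexive; ≤′-step; z≤n; s≤s; _≤?_; _≟_)
open import Data.List.Membership.DecPropositional _≟_ using (_∈?_)
open import Data.Nat.Properties using (≤-trans; ≤-<-trans; ≤⇒≤′; ≮⇒≥; <-irrefl; ≤-pred)
open import Data.Product using (∃; _×_; _,_)
open import Function using (_∘_; case_of_)
open import Relation.Nullary using (¬_; does; yes; no; ¬?)
open import Relation.Nullary.Decidable using (dec-true; dec-false)
open import Relation.Binary.PropositionalEquality using (_≡_; refl; sym; trans; cong; subst)

prefix-length : ∀ y k → length (prefix y k) ≡ k
prefix-length y k = trans (length-map y (upTo k)) (length-upTo k)

prepend : Bool → (ℕ → Bool) → ℕ → Bool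
prepend b y zero    = b
prepend b y (suc i) = y i

prefix-prepend : ∀ b y k → prefix (prepend b y) (suc k) ≡ b ∷ prefix y k
prefix-prepend b y k = cong (b ∷_)
  (trans (map-applyUpTo suc (prepend b y) k) (sym (map-upTo y k)))

isLittlestoneTree-child : ∀ {G d x} b → IsLittlestoneTree G (suc d) x →
  IsLittlestoneTree (λ g → G g × g (x []) ≡ b) d (x ∘ (b ∷_))
isLittlestoneTree-child {x = x} b tree y n n<d
  with g , Gg , agrees ← tree (prepend b y) (suc n) (s≤s n<d)
  = g , (Gg , agrees 0 z≤n) , agreesBelow
  where
  agreesBelow : ∀ k → k ≤ n → g (x (b ∷ prefix y k)) ≡ y k
  agreesBelow k k≤n =
    subst (λ v → g (x v) ≡ y k) (prefix-prepend b y k) (agrees (suc k) (s≤s k≤n))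

isLittlestoneTree-length : ∀ {G d} →
  (∀ y n → n < d → ∃ λ g → G g × (∀ k → k ≤ n → g k ≡ y k)) →
  IsLittlestoneTree G d length
isLittlestoneTree-length realises y n n<d with g , Gg , agrees ← realises y n n<d =
  g , Gg , λ k k≤n → subst (λ m → g m ≡ y k) (sym (prefix-length y k)) (agrees k k≤n)

SupportedOn : Class → List ℕ → Set
SupportedOn G F = ∀ g → G g → ∀ n → n ∉ F → g n ≡ false

supportedOn-upTo : ∀ {G} K → (∀ g → G g → ∀ n → K ≤ n → g n ≡ false) →
  SupportedOn G (upTo K)
supportedOn-upTo K vanishes g Gg n n∉ = vanishes g Gg n (≮⇒≥ (n∉ ∘ ∈-upTo⁺))

supportedOn⇒depth≤length : ∀ {G d x} F → SupportedOn G F →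
  IsLittlestoneTree G d x → d ≤ length F
supportedOn⇒depth≤length {d = zero} F supported tree = z≤n
supportedOn⇒depth≤length {G} {suc d} {x} F supported tree with x [] ∈? F
... | no root∉F with g , Gg , agrees ← tree (λ _ → true) 0 (s≤s z≤n)
  with () ← trans (sym (agrees 0 z≤n)) (supported g Gg (x []) root∉F)
... | yes root∈F = ≤-trans (s≤s depth≤) shorter
  where
  F′ : List ℕ
  F′ = filter (λ m → ¬? (m ≟ x [])) F

  supported′ : SupportedOn (λ g → G g × g (x []) ≡ false) F′
  supported′ g (Gg , g-root) n n∉F′ with n ≟ x []
  ... | yes refl = g-root
  ... | no n≢root = supported g Gg n (λ n∈F → n∉F′ (∈-filter⁺ _ n∈F n≢root))

  depth≤ : d ≤ length F′
  depth≤ = supportedOn⇒depth≤length {x = x ∘ (false ∷_)} F′ supported′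
    (isLittlestoneTree-child {x = x} false tree)

  shorter : suc (length F′) ≤ length F
  shorter = filter-notAll _ F (Any.map (λ root≡m m≢root → m≢root (sym root≡m)) root∈F)

truncate : ℕ → (ℕ → Bool) → ℕ → Bool
truncate n y k = if does (k ≤? n) then y k else false

truncate-finSupp : ∀ n y → FinSupp (truncate n y)
truncate-finSupp n y = suc n , λ k n<k →
  cong (λ b → if b then y k else false) (dec-false (k ≤? n) λ k≤n → <-irrefl refl (≤-<-trans k≤n n<k))

module _ (M : TM) where

  step-halted : ∀ c → isHalted M c ≡ true → step M c ≡ c
  step-halted (config q t hd) with TM.δ M q (t hd)
  ... | nothing = λ _ → refl
  ... | just _  = λ ()

  run-step : ∀ n c → run M n (step M c) ≡ step M (run M n c)
  run-step zero    c = refl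
  run-step (suc n) c = run-step n (step M c)

  haltsWithin-suc : ∀ n → HaltsWithin M n → HaltsWithin M (suc n)
  haltsWithin-suc n halted = subst (λ c → isHalted M c ≡ true)
    (trans (sym (step-halted _ halted)) (sym (run-step n (initConfig M)))) halted

  haltsWithin-mono′ : ∀ {m n} → m ≤′ n → HaltsWithin M m → HaltsWithin M n
  haltsWithin-mono′ (≤′-reflexive refl) halted = halted
  haltsWithin-mono′ (≤′-step {n} m≤′n) halted = haltsWithin-suc n (haltsWithin-mono′ m≤′n halted)

  haltsWithin-mono : ∀ {m n} → m ≤ n → HaltsWithin M m → HaltsWithin M n
  haltsWithin-mono = haltsWithin-mono′ ∘ ≤⇒≤′

  haltsWithin⇒haltsExactly : ∀ n → HaltsWithin M n → ∃ (HaltsExactly M)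
  haltsWithin⇒haltsExactly zero    halted = 0 , halted , λ _ ()
  haltsWithin⇒haltsExactly (suc n) halted with haltsWithin M n in eq
  ... | true  = haltsWithin⇒haltsExactly n eq
  ... | false = suc n , halted , λ m m<1+n haltedₘ →
    case trans (sym eq) (haltsWithin-mono (≤-pred m<1+n) haltedₘ) of λ ()

  H-vanishes : ∀ {K} → HaltsWithin M K → ∀ g → H M g → ∀ n → K ≤ n → g n ≡ false
  H-vanishes halted g (_ , _ , g≡h) n K≤n
    rewrite g≡h n | haltsWithin-mono K≤n halted = refl

  H-isLittlestoneTree-length : ∀ {d} → (∀ k → k < d → ¬ HaltsWithin M k) →
    IsLittlestoneTree (H M) d length
  H-isLittlestoneTree-length notHalted = isLittlestoneTree-length λ y n n<d →
    h M (truncate n y) , (truncate n y , truncate-finSupp n y , λ _ → refl) ,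
    λ k k≤n → agrees y k k≤n (¬-not (notHalted k (≤-<-trans k≤n n<d)))
    where
    agrees : ∀ {n} y k → k ≤ n → haltsWithin M k ≡ false → h M (truncate n y) k ≡ y k
    agrees {n} y k k≤n running rewrite running | dec-true (k ≤? n) k≤n = refl

proposition4p7 : (M : TM) →
    (∀ (K : ℕ) → HaltsExactly M K → LdimIs (H M) (fin K)) ×
    (¬ (∃ λ K → HaltsExactly M K) → LdimIs (H M) ∞)
proposition4p7 M = haltingCase , nonHaltingCase
  where
  haltingCase : ∀ K → HaltsExactly M K → LdimIs (H M) (fin K)
  haltingCase K (halted , notBefore) =
    (length , H-isLittlestoneTree-length M notBefore) ,
    λ d (x , tree) → subst (d ≤_) (length-upTo K)
      (supportedOn⇒depth≤length {x = x} (upTo K)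
        (supportedOn-upTo K (H-vanishes M halted)) tree)

  nonHaltingCase : ¬ (∃ λ K → HaltsExactly M K) → LdimIs (H M) ∞
  nonHaltingCase neverHalts d =
    length , H-isLittlestoneTree-length M λ k _ → neverHalts ∘ haltsWithin⇒haltsExactly M k
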